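{- Suppose $\Gamma\vdash s\triangleright\Delta$ is derivable and $s$ is a $\sigma\pi\alpha$-normal form (with respect to $\rightarrow$); then $s$ has one of the forms: (i) $id$; (ii) $\pi_{a_1\ldots a_n}$ ($n\geqslant1$); (iii) $\langle id\,,\,N_1\backslash b_1\,,\,\ldots\,,\,N_k\backslash b_k\rangle$ ($k\geqslant1$); (iv) $\langle\pi_{a_1\ldots a_n}\,,\,N_1\backslash b_1\,,\,\ldots\,,\,N_k\backslash b_k\rangle$ ($n\geqslant1,k\geqslant1$).
   Context: Calculus $\lambda\pi$: terms $M,N::= a\mid MN\mid\lambda a.M\mid s\circ M$, substitutions $s,q::= id\mid\pi_a\mid\langle s\,,\,N\backslash a\rangle\mid s\circ q$. Notation: $\langle s\,,\,N_1\backslash b_1,\ldots,N_k\backslash b_k\rangle$ abbreviates $\langle\ldots\langle s\,,\,N_1\backslash b_1\rangle,\ldots,N_k\backslash b_k\rangle$; $\pi_{a_1\ldots a_n}$ denotes $(\ldots((\pi_{a_1}\circ\pi_{a_2})\circ\ldots)\circ\pi_{a_n}$; $s\circ q\circ r$ means $s\circ(q\circ r)$. Derivable judgements $\Gamma\vdash M$, $\Gamma\vdash s\triangleright\Delta$ (contexts = lists of variables with repetitions): (i) $\Gamma,a\vdash a$; (ii) $\Gamma\vdash a\Rightarrow\Gamma,b\vdash a$ ($a\neq b$); (iii) application; (iv) $\Gamma,a\vdash M\Rightarrow\Gamma\vdash\lambda a.M$; (v) $\Gamma\vdash s\triangleright\Delta,\Delta\vdash M\Rightarrow\Gamma\vdash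 s\circ M$; (vi) $\Gamma\vdash id\triangleright\Gamma$; (vii) $\Gamma,a\vdash\pi_a\triangleright\Gamma$; (viii) $\Gamma\vdash s\triangleright\Delta,\Gamma\vdash N\Rightarrow\Gamma\vdash\langle s\,,\,N\backslash a\rangle\triangleright\Delta,a$; (ix) $\Gamma\vdash s\triangleright\Delta,\Delta\vdash q\triangleright\Sigma\Rightarrow\Gamma\vdash s\circ q\triangleright\Sigma$. $\sigma\pi\alpha$ is the compatible closure of the rules (Abs) $s\circ\lambda a.M\rightarrow\lambda a.\langle\pi_a\circ s\,,\,a\backslash a\rangle\circ M$; (App) $s\circ(MN)\rightarrow(s\circ M)(s\circ N)$; (ConsVar) $\langle s\,,\,N\backslash a\rangle\circ a\rightarrow N$; (New) $\langle s\,,\,N\backslash a\rangle\circ b\rightarrow s\circ b$ ($a\neq b$); (IdVar) $id\circ a\rightarrow a$; (Clos) $s\circ q\circ M\rightarrow(s\circ q)\circ M$; (Ass) $s\circ q\circ r\rightarrow(s\circ q)\circ r$; (IdR) $s\circ id\rightarrow s$; (IdShift) $id\circ\pi_a\rightarrow\pi_a$; (ConsShift) $\langle s\,,\,N\backslash a\rangle\circ\pi_a\rightarrow s$; (Map) $s\circ\langle q\,,\,N\backslash a\rangle\rightarrow\langle s\circ q\,,\,s\circ N\backslash a\rangle$; ($\pi_1$) $\pi_a\circ b\rightarrow b$ ($a\neq b$); ($\pi_2$) $(s\circ\pi_a)\circ b\rightarrow s\circ b$ ($a\neq b$); ($\alpha_1$) $\lambda a.M\rightarrow\lambda b.\langle\pi_b\,,\,b\backslash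 a\rangle\circ M$ (under a free-variable side condition); i.e. $\lambda\pi$ without Beta. -}

module Defs where

open import Data.Nat using (ℕ)
open import Data.List using (List; []; _∷_; foldl)
open import Data.Product using (_×_; _,_; ∃)
open import Relation.Nullary using (¬_)
open import Relation.Binary.PropositionalEquality using (_≡_)

Var : Set
Var = ℕ

mutual
  -- terms  M ::= a | M N | λa.M | s ∘ M
  data Term : Set where
    var  : Var → Term
    app  : Term → Term → Term
    lam  : Var → Term → Term
    clos : Subst → Term → Term

  data Subst : Set where
    id   : Subst
    π    : Var → Subst
    cons : Subst → Term → Var → Subst     -- cons s N a  =  ⟨ s , N \ a ⟩
    comp : Subst → Subst → Subst          -- comp s q    =  s ∘ q

-- Contexts: lists of variables (with repetitions). The context "Γ , a"
-- is represented as  a ∷ Γ  (the head is the last/rightmost variable).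
Ctx : Set
Ctx = List Var

mutual
  data _⊢_ : Ctx → Term → Set where
    ax    : ∀ {Γ a} → (a ∷ Γ) ⊢ var a
    weak  : ∀ {Γ a b} → Γ ⊢ var a → ¬ a ≡ b → (b ∷ Γ) ⊢ var a
    tapp  : ∀ {Γ M N} → Γ ⊢ M → Γ ⊢ N → Γ ⊢ app M N
    tlam  : ∀ {Γ a M} → (a ∷ Γ) ⊢ M → Γ ⊢ lam a M
    tclos : ∀ {Γ Δ s M} → Γ ⊢ s ▷ Δ → Δ ⊢ M → Γ ⊢ clos s M

  data _⊢_▷_ : Ctx → Subst → Ctx → Set where
    tid   : ∀ {Γ} → Γ ⊢ id ▷ Γ
    tπ    : ∀ {Γ a} → (a ∷ Γ) ⊢ π a ▷ Γ
    tcons : ∀ {Γ Δ s N a} → Γ ⊢ s ▷ Δ → Γ ⊢ N → Γ ⊢ cons s N a ▷ (a ∷ Δ)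
    tcomp : ∀ {Γ Δ Σ s q} → Γ ⊢ s ▷ Δ → Δ ⊢ q ▷ Σ → Γ ⊢ comp s q ▷ Σ

-- Free variables.
--   FV b M      : b occurs free in M
--   FVS b s c   : b occurs free in the image of the variable c under s
mutual
  data FV : Var → Term → Set where
    fvar  : ∀ {a} → FV a (var a)
    fappl : ∀ {b M N} → FV b M → FV b (app M N)
    fappr : ∀ {b M N} → FV b N → FV b (app M N)
    flam  : ∀ {a b M} → FV b M → ¬ b ≡ a → FV b (lam a M)
    fclos : ∀ {b c s M} → FV c M → FVS b s c → FV b (clos s M)

  data FVS : Var → Subst → Var → Set where
    sid    : ∀ {c} → FVS c id c
    sπ     : ∀ {a c} → FVS c (π a) c
    sconsh : ∀ {b s N a} → FV b N → FVS b (cons s N a) a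
    sconst : ∀ {b c s N a} → FVS b s c → ¬ c ≡ a → FVS b (cons s N a) c
    scomp  : ∀ {b c d s q} → FVS d q c → FVS b s d → FVS b (comp s q) c

mutual
  data _⟶_ : Term → Term → Set where
    Abs     : ∀ {s a M} → clos s (lam a M) ⟶ lam a (clos (cons (comp (π a) s) (var a) a) M)
    App     : ∀ {s M N} → clos s (app M N) ⟶ app (clos s M) (clos s N)
    ConsVar : ∀ {s N a} → clos (cons s N a) (var a) ⟶ N
    New     : ∀ {s N a b} → ¬ a ≡ b → clos (cons s N a) (var b) ⟶ clos s (var b)
    IdVar   : ∀ {a} → clos id (var a) ⟶ var a
    Clos    : ∀ {s q M} → clos s (clos q M) ⟶ clos (comp s q) M
    π₁      : ∀ {a b} → ¬ a ≡ b → clos (π a) (var b) ⟶ var b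
    π₂      : ∀ {s a b} → ¬ a ≡ b → clos (comp s (π a)) (var b) ⟶ clos s (var b)
    α₁      : ∀ {a b M} → ¬ FV b (lam a M) → lam a M ⟶ lam b (clos (cons (π b) (var b) a) M)
    appˡ    : ∀ {M M' N} → M ⟶ M' → app M N ⟶ app M' N
    appʳ    : ∀ {M N N'} → N ⟶ N' → app M N ⟶ app M N'
    lamᶜ    : ∀ {a M M'} → M ⟶ M' → lam a M ⟶ lam a M'
    closˡ   : ∀ {s s' M} → s ⟶ₛ s' → clos s M ⟶ clos s' M
    closʳ   : ∀ {s M M'} → M ⟶ M' → clos s M ⟶ clos s M'

  data _⟶ₛ_ : Subst → Subst → Set where
    Ass       : ∀ {s q r} → comp s (comp q r) ⟶ₛ comp (comp s q) r
    IdR       : ∀ {s} → comp s id ⟶ₛ s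
    IdShift   : ∀ {a} → comp id (π a) ⟶ₛ π a
    ConsShift : ∀ {s N a} → comp (cons s N a) (π a) ⟶ₛ s
    Map       : ∀ {s q N a} → comp s (cons q N a) ⟶ₛ cons (comp s q) (clos s N) a
    consˡ     : ∀ {s s' N a} → s ⟶ₛ s' → cons s N a ⟶ₛ cons s' N a
    consʳ     : ∀ {s N N' a} → N ⟶ N' → cons s N a ⟶ₛ cons s N' a
    compˡ     : ∀ {s s' q} → s ⟶ₛ s' → comp s q ⟶ₛ comp s' q
    compʳ     : ∀ {s q q'} → q ⟶ₛ q' → comp s q ⟶ₛ comp s q'

NormalS : Subst → Set
NormalS s = ∀ s' → ¬ (s ⟶ₛ s')

-- π_{a₁…aₙ} = (…((π_{a₁} ∘ π_{a₂}) ∘ …) ∘ π_{aₙ}, given a₁ and the list a₂…aₙ (n ≥ 1)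
πs : Var → List Var → Subst
πs a₁ as = foldl (λ acc a → comp acc (π a)) (π a₁) as

-- ⟨ s , N₁\b₁ , … , Nₖ\bₖ ⟩ = ⟨…⟨ s , N₁\b₁ ⟩ , … , Nₖ\bₖ⟩
conses : Subst → List (Term × Var) → Subst
conses s l = foldl (λ acc p → cons acc (Data.Product.proj₁ p) (Data.Product.proj₂ p)) s l

module Submission where

-- The only interesting
-- case is a composition  s ∘ q : the rules (IdR), (Ass), (Map) force q = π_b;
-- (IdShift) excludes s = id; and if s is an extension ⟨ s' , N\c ⟩ then
-- typing forces c = b, so (ConsShift) applies.  Hence s is a chain of shifts
-- and so is s ∘ π_b.

open import Defs
open import Data.List using (List; []; _∷_; _∷ʳ_)
open import Data.List.Properties using (foldl-∷ʳ)
open import Data.Product using (_×_; ∃; ∃₂; _,_)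
open import Data.Sum using (_⊎_; inj₁; inj₂)
open import Data.Empty using (⊥-elim)
open import Relation.Binary.PropositionalEquality using (_≡_; refl; sym)

data Shifts : Subst → Set where
  shift : ∀ {a} → Shifts (π a)
  _∘π   : ∀ {s a} → Shifts s → Shifts (comp s (π a))

Base : Subst → Set
Base s = s ≡ id ⊎ Shifts s

data Extends (B : Subst → Set) : Subst → Set where
  extend : ∀ {s N a} → B s → Extends B (cons s N a)
  _,ext  : ∀ {s N a} → Extends B s → Extends B (cons s N a)

-- Typing forces the ConsShift redex: in  ⟨ s , N\c ⟩ ∘ π_b  the middle
-- context must be both  Δ , c  and  Σ , b, so c = b.
consShiftRedex : ∀ {Γ Δ Σ s N c b} →
  Γ ⊢ cons s N c ▷ Δ → Δ ⊢ π b ▷ Σ → comp (cons s N c) (π b) ⟶ₛ s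
consShiftRedex (tcons _ _) tπ = ConsShift

normalShape : ∀ {Γ Δ s} → Γ ⊢ s ▷ Δ → NormalS s → Base s ⊎ Extends Base s
normalShape tid nf = inj₁ (inj₁ refl)
normalShape tπ  nf = inj₁ (inj₂ shift)
normalShape (tcons d _) nf with normalShape d (λ s' r → nf _ (consˡ r))
... | inj₁ base = inj₂ (extend base)
... | inj₂ ext  = inj₂ (ext ,ext)
normalShape {s = comp s id}         (tcomp _ _) nf = ⊥-elim (nf _ IdR)
normalShape {s = comp s (comp q r)} (tcomp _ _) nf = ⊥-elim (nf _ Ass)
normalShape {s = comp s (cons q N a)} (tcomp _ _) nf = ⊥-elim (nf _ Map)
normalShape {s = comp s (π b)} (tcomp d e) nf
  with normalShape d (λ s' r → nf _ (compˡ r))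
... | inj₁ (inj₁ refl) = ⊥-elim (nf _ IdShift)
... | inj₁ (inj₂ sh)   = inj₁ (inj₂ (sh ∘π))
... | inj₂ (extend _)  = ⊥-elim (nf _ (consShiftRedex d e))
... | inj₂ (_ ,ext)    = ⊥-elim (nf _ (consShiftRedex d e))

πs-∷ʳ : ∀ a as b → πs a (as ∷ʳ b) ≡ comp (πs a as) (π b)
πs-∷ʳ a as b = foldl-∷ʳ _ (π a) b as

conses-∷ʳ : ∀ s ps N b → conses s (ps ∷ʳ (N , b)) ≡ cons (conses s ps) N b
conses-∷ʳ s ps N b = foldl-∷ʳ _ s (N , b) ps

shiftsList : ∀ {s} → Shifts s → ∃₂ λ a as → s ≡ πs a as
shiftsList (shift {a}) = a , [] , refl
shiftsList (_∘π {a = b} sh) with shiftsList sh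
... | a , as , refl = a , as ∷ʳ b , sym (πs-∷ʳ a as b)

extendsList : ∀ {B s} → Extends B s →
  ∃ λ s₀ → B s₀ × ∃₂ λ p ps → s ≡ conses s₀ (p ∷ ps)
extendsList (extend {s} {N} {a} b) = s , b , (N , a) , [] , refl
extendsList (_,ext {N = N} {a} ext) with extendsList ext
... | s₀ , b , p , ps , refl = s₀ , b , p , ps ∷ʳ (N , a) , sym (conses-∷ʳ s₀ (p ∷ ps) N a)

mainTheorem4 : ∀ (Γ Δ : Ctx) (s : Subst) → Γ ⊢ s ▷ Δ → NormalS s →
      (s ≡ id)
    ⊎ (∃₂ λ (a₁ : Var) (as : List Var) → s ≡ πs a₁ as)
    ⊎ (∃₂ λ (p : Term × Var) (ps : List (Term × Var)) → s ≡ conses id (p ∷ ps))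
    ⊎ (∃₂ λ (a₁ : Var) (as : List Var) → ∃₂ λ (p : Term × Var) (ps : List (Term × Var)) →
        s ≡ conses (πs a₁ as) (p ∷ ps))
mainTheorem4 Γ Δ s d nf with normalShape d nf
... | inj₁ (inj₁ s≡id) = inj₁ s≡id
... | inj₁ (inj₂ sh)   = inj₂ (inj₁ (shiftsList sh))
... | inj₂ ext with extendsList ext
...   | _ , inj₁ refl , p , ps , s≡ = inj₂ (inj₂ (inj₁ (p , ps , s≡)))
...   | _ , inj₂ sh , p , ps , s≡ with shiftsList sh
...     | a , as , refl = inj₂ (inj₂ (inj₂ (a , as , p , ps , s≡)))
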